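{- Let $\mathcal F$ be a Fano plane, $\mathbb F$ a field of characteristic not $2$, and $\epsilon$ a multiplication factor such that $(\mathbb O_{\mathcal F},\mathbf 1,\epsilon)$ is a composition algebra. (i) If $(\mathbb O_{\mathcal F},\mathbf 1,\epsilon)\in\mathbb O_{\mathcal F}{}^+_1$, then there exists a unique oriented map $P\mapsto\alpha_P$ such that $\epsilon_{PQ}=(-1)^{\alpha_P(Q)}$ for all $P\ne Q$ in $\mathcal F$. (ii) If $(\mathbb O_{\mathcal F},\mathbf 1,\epsilon)\in\mathbb O_{\mathcal F}{}^-_1$, then there exists a unique oriented map $P\mapsto\alpha_P$ such that $\epsilon_{PQ}=-(-1)^{\alpha_P(Q)}$ for all $P\ne Q$ in $\mathcal F$.
   Context: A Fano plane is a set $\mathcal F$ of seven points together with a set of seven $3$-element subsets of $\mathcal F$ called lines, such that any two distinct points lie in a unique line and any two distinct lines meet in a unique point. The Fano cube is $V_{\mathcal F}=\mathcal F\cup\{0\}$ with the unique $\mathbb Z_2$-vector space structure with zero $0$ such that for distinct $P,Q\in\mathcal F$, $P+Q$ is the third point of the line through $P$ and $Q$; $V_{\mathcal F}^\ast$ is its dual. An oriented map is a map $\alpha:\mathcal F\to V_{\mathcal F}^\ast$, $P\mapsto\alpha_P$, with $\alpha_P(P)=1$ for all $P$ and $\alpha_P(Q)+\alpha_Q(P)=1$ for $P\ne Q$. A multiplication factor is a map $\epsilon:\{(P,Q)\in\mathcal F^2:P\ne Q\}\to\{ -1,1\}$ with $\epsilon_{QP}=-\epsilon_{PQ}$; the future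 of $P$ is $\overrightarrow{P}=\{Q\ne P:\epsilon_{PQ}=1\}$ and the past is $\overleftarrow{P}=\{Q\ne P:\epsilon_{PQ}=-1\}$. $\mathbb O_{\mathcal F}$ is the $\mathbb F$-vector space of $\mathbb F$-valued functions on $V_{\mathcal F}$, with basis $e_P$ ($P\in V_{\mathcal F}$), $e_P$ the indicator function of $P$. The multiplication $\cdot_\epsilon$ is bilinear with $e_P\cdot_\epsilon e_Q=\epsilon_{PQ}e_{P+Q}$ for $P\ne Q$ in $\mathcal F$, $e_P\cdot_\epsilon e_P=-e_0$ for $P\in\mathcal F$, and $e_0$ a two-sided unit. $\mathbf 1$ denotes the quadratic form $N_{\mathbb O}(\lambda^0e_0+\sum_P\lambda^Pe_P)=(\lambda^0)^2+\sum_P(\lambda^P)^2$. $(\mathbb O_{\mathcal F},\mathbf 1,\epsilon)$ is a composition algebra iff $N_{\mathbb O}(Z\cdot_\epsilon W)=N_{\mathbb O}(Z)N_{\mathbb O}(W)$ for all $Z,W$. $\mathbb O_{\mathcal F}{}^+_1$ (resp. $\mathbb O_{\mathcal F}{}^-_1$) is the set of composition algebras $(\mathbb O_{\mathcal F},\mathbf 1,\epsilon)$ such that $\overrightarrow{P}$ (resp. $\overleftarrow{P}$) is a line for all $P\in\mathcal F$. -}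

module Defs where

open import Level using (Level; _⊔_)
open import Data.Bool using (Bool; true; false; _∧_; _xor_; if_then_else_; not)
open import Data.Nat using (ℕ)
open import Data.Fin using (Fin; zero; suc)
open import Data.Nat as ℕ using ()
open import Data.Fin.Properties using (_≟_)
open import Data.Maybe using (Maybe; just; nothing)
open import Data.Product using (Σ; _×_; _,_; ∃; ∃!)
open import Data.Sign using (Sign) renaming (+ to s+; - to s-)
open import Relation.Nullary using (¬_; does)
open import Relation.Binary.PropositionalEquality using (_≡_; _≢_)
open import Algebra.Bundles using (CommutativeRing)

record Field (c ℓ : Level) : Set (Level.suc (c ⊔ ℓ)) where
  field
    commutativeRing : CommutativeRing c ℓ
  open CommutativeRing commutativeRing public
  field
    1≉0     : ¬ (1# ≈ 0#)
    inverse : ∀ x → ¬ (x ≈ 0#) → Σ Carrier (λ y → (x * y) ≈ 1#)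

CharNot2 : ∀ {c ℓ} → Field c ℓ → Set ℓ
CharNot2 F = ¬ ((1# + 1#) ≈ 0#)
  where open Field F

countB : ∀ {n} → (Fin n → Bool) → ℕ
countB {ℕ.zero}  f = 0
countB {ℕ.suc n} f = (if f zero then ℕ.suc else (λ k → k)) (countB (λ i → f (suc i)))

anyB : ∀ {n} → (Fin n → Bool) → Bool
anyB {ℕ.zero}  f = false
anyB {ℕ.suc n} f = if f zero then true else anyB (λ i → f (suc i))

-- Fano plane: seven points (represented as Fin 7) and seven lines
-- (indexed by Fin 7, given by their incidence predicates).
-- on l p = true  iff  point p lies on line l.

record FanoPlane : Set where
  field
    on : Fin 7 → Fin 7 → Bool
    lines-distinct : ∀ l m → (∀ p → on l p ≡ on m p) → l ≡ m
    line-size : ∀ l → countB (on l) ≡ 3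
    two-points : ∀ p q → p ≢ q →
      ∃! _≡_ (λ l → (on l p ≡ true) × (on l q ≡ true))
    two-lines : ∀ l m → l ≢ m →
      ∃! _≡_ (λ p → (on l p ≡ true) × (on m p ≡ true))

module _ (𝓕 : FanoPlane) where
  open FanoPlane 𝓕

  neqB : Fin 7 → Fin 7 → Bool
  neqB p q = not (does (p ≟ q))

  -- For points P, Q, R:  isSum P Q R = true  iff  P ≠ Q and R = P + Q
  -- in the Fano cube, i.e. R is the third point of the line through P, Q.
  isSum : Fin 7 → Fin 7 → Fin 7 → Bool
  isSum p q r = neqB p q ∧ neqB r p ∧ neqB r q
                ∧ anyB (λ l → on l p ∧ on l q ∧ on l r)

  -- Fano cube V_F = F ∪ {0}, represented as Maybe (Fin 7), nothing = 0.
  VF : Set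
  VF = Maybe (Fin 7)

  -- Linear functionals V_F → Z₂ (elements of V_F^*), written out:
  -- α(0) = 0, α(P+P) = α(0) = α(P)+α(P) automatically, and
  -- α(P+Q) = α(P) + α(Q) for distinct P, Q.
  IsLinear : (VF → Bool) → Set
  IsLinear a = (a nothing ≡ false)
             × (∀ p q r → isSum p q r ≡ true → a (just r) ≡ (a (just p) xor a (just q)))

  IsOrientedMap : (Fin 7 → VF → Bool) → Set
  IsOrientedMap α = (∀ p → IsLinear (α p))
                  × (∀ p → α p (just p) ≡ true)
                  × (∀ p q → p ≢ q → (α p (just q) xor α q (just p)) ≡ true)

  -- Multiplication factor: ε defined on pairs P ≠ Q (values on the
  -- diagonal are irrelevant and never used), with ε_QP = -ε_PQ.
  IsMultFactor : (Fin 7 → Fin 7 → Sign) → Set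
  IsMultFactor ε = ∀ p q → p ≢ q → ε q p ≡ Data.Sign.opposite (ε p q)

  FutureIsLine : (Fin 7 → Fin 7 → Sign) → Fin 7 → Set
  FutureIsLine ε p = ∃ λ l → ∀ q → ((q ≢ p × ε p q ≡ s+) → on l q ≡ true)
                                  × (on l q ≡ true → (q ≢ p × ε p q ≡ s+))

  PastIsLine : (Fin 7 → Fin 7 → Sign) → Fin 7 → Set
  PastIsLine ε p = ∃ λ l → ∀ q → ((q ≢ p × ε p q ≡ s-) → on l q ≡ true)
                                × (on l q ≡ true → (q ≢ p × ε p q ≡ s-))

  signPow : Bool → Sign
  signPow false = s+
  signPow true  = s-

  module Alg {c ℓ} (𝔽 : Field c ℓ) where
    open Field 𝔽 using (Carrier; _≈_; _+_; _*_; _-_; -_; 0#; 1#)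

    ∑ : ∀ {n} → (Fin n → Carrier) → Carrier
    ∑ {ℕ.zero}  f = 0#
    ∑ {ℕ.suc n} f = f zero + ∑ (λ i → f (suc i))

    -- 𝕆_F : F-valued functions on V_F; Z nothing = λ⁰, Z (just P) = λ^P
    𝕆 : Set c
    𝕆 = VF → Carrier

    ⟦_⟧ : Sign → Carrier
    ⟦ s+ ⟧ = 1#
    ⟦ s- ⟧ = - 1#

    -- the multiplication ·_ε, bilinear extension of
    -- e_P e_Q = ε_PQ e_{P+Q} (P ≠ Q), e_P e_P = - e_0, e_0 unit.
    mul : (Fin 7 → Fin 7 → Sign) → 𝕆 → 𝕆 → 𝕆
    mul ε Z W nothing =
      (Z nothing * W nothing) - ∑ (λ p → Z (just p) * W (just p))
    mul ε Z W (just r) =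
      (Z nothing * W (just r)) + (Z (just r) * W nothing)
      + ∑ (λ p → ∑ (λ q →
          if isSum p q r then ⟦ ε p q ⟧ * (Z (just p) * W (just q)) else 0#))

    N𝕆 : 𝕆 → Carrier
    N𝕆 Z = (Z nothing * Z nothing) + ∑ (λ p → Z (just p) * Z (just p))

    IsCompositionAlgebra : (Fin 7 → Fin 7 → Sign) → Set (c ⊔ ℓ)
    IsCompositionAlgebra ε = ∀ (Z W : 𝕆) → N𝕆 (mul ε Z W) ≈ (N𝕆 Z * N𝕆 W)

    In𝕆⁺₁ : (Fin 7 → Fin 7 → Sign) → Set (c ⊔ ℓ)
    In𝕆⁺₁ ε = IsCompositionAlgebra ε × (∀ p → FutureIsLine ε p)

    In𝕆⁻₁ : (Fin 7 → Fin 7 → Sign) → Set (c ⊔ ℓ)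
    In𝕆⁻₁ ε = IsCompositionAlgebra ε × (∀ p → PastIsLine ε p)

  -- "there exists a unique oriented map α with property R":
  -- uniqueness up to equality of the maps (pointwise, as functions).
  ExistsUniqueOriented : ((Fin 7 → VF → Bool) → Set) → Set
  ExistsUniqueOriented R =
    Σ (Fin 7 → VF → Bool) λ α → (IsOrientedMap α × R α)
      × (∀ β → IsOrientedMap β → R β → ∀ p x → β p x ≡ α p x)

{-# OPTIONS --safe #-}
-- The indicator of the complement of a line is a linear functional on the Fano cube.  If the
-- future (or past) of each point P is a line l_P, take α_P to be this functional: P is
-- not in its own future, so α_P(P) = 1, and Q ↦ ε_PQ is ±(-1)^α_P(Q) by construction.
-- Antisymmetry of ε then gives α_P(Q) + α_Q(P) = 1, and uniqueness holds because the
-- sign relation fixes α_P(Q) for Q ≠ P while α_P(P) = 1 and α_P(0) = 0 are forced.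
module Submission where

open import Defs
open import Data.Bool using (Bool; true; false; _∧_; _xor_; not; if_then_else_)
open import Data.Bool.Properties using (∧-conicalˡ; ∧-conicalʳ; xor-same; not-distribʳ-xor)
open import Data.Empty using (⊥; ⊥-elim)
open import Data.Fin using (Fin; zero; suc)
open import Data.Fin.Properties using (_≟_)
open import Data.Maybe using (just; nothing)
open import Data.Nat as ℕ using (ℕ)
open import Data.Nat.Properties using (1+n≢0)
open import Data.Product using (_×_; _,_; proj₁; proj₂; ∃)
open import Data.Sign using (Sign; opposite) renaming (+ to s+; - to s-)
open import Data.Sign.Properties using (s≢opposite[s])
open import Function using (_∘_)
open import Relation.Binary.PropositionalEquality
  using (_≡_; _≢_; refl; sym; trans; cong; ≢-sym; module ≡-Reasoning)
open import Relation.Nullary using (does; yes; no)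

countB-cong : ∀ {n} {f g : Fin n → Bool} → (∀ i → f i ≡ g i) → countB f ≡ countB g
countB-cong {ℕ.zero}  f≗g = refl
countB-cong {ℕ.suc n} {f} {g} f≗g
  rewrite f≗g zero | countB-cong {f = λ i → f (suc i)} {g = λ i → g (suc i)} (λ i → f≗g (suc i)) = refl

remove : ∀ {n} → Fin n → (Fin n → Bool) → Fin n → Bool
remove x f y = if does (y ≟ x) then false else f y

countB-remove : ∀ {n} (f : Fin n → Bool) {x} → f x ≡ true →
                countB f ≡ ℕ.suc (countB (remove x f))
countB-remove {ℕ.suc n} f {zero} fx rewrite fx =
  cong ℕ.suc (countB-cong {f = λ i → f (suc i)} (λ i → refl))
countB-remove {ℕ.suc n} f {suc x} fx with f zero | countB-remove (λ i → f (suc i)) fx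
... | true  | IH = cong ℕ.suc IH
... | false | IH = IH

countB-remove-pred : ∀ {n k} {f : Fin n → Bool} {x} → countB f ≡ ℕ.suc k → f x ≡ true →
                     countB (remove x f) ≡ k
countB-remove-pred {f = f} f#k fx = cong ℕ.pred (trans (sym (countB-remove f fx)) f#k)

remove-keeps : ∀ {n} {f : Fin n → Bool} {x y} → y ≢ x → f y ≡ true → remove x f y ≡ true
remove-keeps {x = x} {y} y≢x fy with y ≟ x
... | yes y≡x = ⊥-elim (y≢x y≡x)
... | no  _   = fy

countB≡3⇒no-fourth : ∀ {n} (f : Fin n → Bool) {p q r x} → countB f ≡ 3 →
  f p ≡ true → f q ≡ true → f r ≡ true → f x ≡ true →
  q ≢ p → r ≢ p → r ≢ q → x ≢ p → x ≢ q → x ≢ r → ⊥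
countB≡3⇒no-fourth {n} f {p} {q} {r} {x} f#3 fp fq fr fx q≢p r≢p r≢q x≢p x≢q x≢r =
  1+n≢0 (trans (sym (countB-remove f₃ {x} f₃x)) f₃#0)
  where
  f₁ f₂ f₃ : Fin n → Bool
  f₁ = remove p f
  f₂ = remove q f₁
  f₃ = remove r f₂
  f₃#0 : countB f₃ ≡ 0
  f₃#0 = countB-remove-pred {f = f₂}
           (countB-remove-pred {f = f₁} (countB-remove-pred {f = f} f#3 fp)
             (remove-keeps {f = f} q≢p fq))
           (remove-keeps {f = f₁} r≢q (remove-keeps {f = f} r≢p fr))
  f₃x : f₃ x ≡ true
  f₃x = remove-keeps {f = f₂} x≢r (remove-keeps {f = f₁} x≢q (remove-keeps {f = f} x≢p fx))

∧≡true : ∀ {a b} → a ∧ b ≡ true → (a ≡ true) × (b ≡ true)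
∧≡true {a} {b} ab = ∧-conicalˡ a b ab , ∧-conicalʳ a b ab

anyB⇒∃ : ∀ {n} (f : Fin n → Bool) → anyB f ≡ true → ∃ λ i → f i ≡ true
anyB⇒∃ {ℕ.suc n} f any with f zero in f0
... | true  = zero , f0
... | false with anyB⇒∃ (λ i → f (suc i)) any
...   | i , fi = suc i , fi

xor-not : ∀ a → a xor not a ≡ true
xor-not a = trans (sym (not-distribʳ-xor a a)) (cong not (xor-same a))

≢⇒≡opposite : ∀ {s t : Sign} → s ≢ t → s ≡ opposite t
≢⇒≡opposite { s+ } { s+ } s≢t = ⊥-elim (s≢t refl)
≢⇒≡opposite { s+ } { s- } _   = refl
≢⇒≡opposite { s- } { s+ } _   = refl
≢⇒≡opposite { s- } { s- } s≢t = ⊥-elim (s≢t refl)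

module _ (𝓕 : FanoPlane) where
  open FanoPlane 𝓕

  neqB⇒≢ : ∀ {p q} → neqB 𝓕 p q ≡ true → p ≢ q
  neqB⇒≢ {p} {q} p≠q with p ≟ q
  neqB⇒≢ () | yes _
  ... | no p≢q = p≢q

  isSum⇒collinear : ∀ {p q r} → isSum 𝓕 p q r ≡ true →
    p ≢ q × r ≢ p × r ≢ q × ∃ λ m → on m p ≡ true × on m q ≡ true × on m r ≡ true
  isSum⇒collinear {p} {q} {r} sum =
    let p≠q , rest      = ∧≡true sum
        r≠p , rest′     = ∧≡true rest
        r≠q , collinear = ∧≡true rest′
        m , mpqr        = anyB⇒∃ (λ l → on l p ∧ on l q ∧ on l r) collinear
        mp , mqr        = ∧≡true mpqr
        mq , mr         = ∧≡true mqr
    in neqB⇒≢ p≠q , neqB⇒≢ r≠p , neqB⇒≢ r≠q , m , mp , mq , mr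

  -- A line L meets every other line in exactly one point, so it contains exactly
  -- one or all three of any three distinct collinear points.
  off-line-xor : ∀ L m {p q r} → p ≢ q → r ≢ p → r ≢ q →
    on m p ≡ true → on m q ≡ true → on m r ≡ true →
    not (on L r) ≡ not (on L p) xor not (on L q)
  off-line-xor L m {p} {q} {r} p≢q r≢p r≢q mp mq mr with m ≟ L
  ... | yes refl rewrite mp | mq | mr = refl
  ... | no m≢L with two-lines m L m≢L
  ... | x , (mx , Lx) , meet-unique = by-meet
    where
    off-L : ∀ {a} → on m a ≡ true → a ≢ x → on L a ≡ false
    off-L {a} ma a≢x with on L a in La
    ... | true  = ⊥-elim (a≢x (sym (meet-unique (ma , La))))
    ... | false = refl
    by-meet : not (on L r) ≡ not (on L p) xor not (on L q)
    by-meet with x ≟ p | x ≟ q | x ≟ r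
    ... | yes refl | _ | _
      rewrite Lx | off-L mq (≢-sym p≢q) | off-L mr r≢p = refl
    ... | no _ | yes refl | _
      rewrite Lx | off-L mp p≢q | off-L mr r≢q = refl
    ... | no _ | no _ | yes refl
      rewrite Lx | off-L mp (≢-sym r≢p) | off-L mq (≢-sym r≢q) = refl
    ... | no x≢p | no x≢q | no x≢r =
      ⊥-elim (countB≡3⇒no-fourth (on m) (line-size m) mp mq mr mx
                (≢-sym p≢q) r≢p r≢q x≢p x≢q x≢r)

  offLine : Fin 7 → VF 𝓕 → Bool
  offLine l nothing  = false
  offLine l (just x) = not (on l x)

  offLine-isLinear : ∀ l → IsLinear 𝓕 (offLine l)
  offLine-isLinear l = refl , λ p q r sum →
    let p≢q , r≢p , r≢q , m , mp , mq , mr = isSum⇒collinear sum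
    in off-line-xor l m p≢q r≢p r≢q mp mq mr

  -- FutureIsLine and PastIsLine are SignLine + and SignLine −.
  SignLine : Sign → (Fin 7 → Fin 7 → Sign) → Fin 7 → Set
  SignLine s ε p = ∃ λ l → ∀ q → ((q ≢ p × ε p q ≡ s) → on l q ≡ true)
                                × (on l q ≡ true → (q ≢ p × ε p q ≡ s))

  signLine-avoids : ∀ {s ε p} ((l , l≡) : SignLine s ε p) → on l p ≡ false
  signLine-avoids {p = p} (l , l≡) with on l p in lp
  ... | true  = ⊥-elim (proj₁ (proj₂ (l≡ p) lp) refl)
  ... | false = refl

  -- g is the sign convention: signPow for the future, opposite ∘ signPow for the past.
  module _ (g : Bool → Sign) (g-not : ∀ b → g (not b) ≡ opposite (g b)) where

    g-injective : ∀ {a b} → g a ≡ g b → a ≡ b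
    g-injective {true}  {true}  _  = refl
    g-injective {false} {false} _  = refl
    g-injective {true}  {false} ga≡gb =
      ⊥-elim (s≢opposite[s] (g false) (trans (sym ga≡gb) (g-not false)))
    g-injective {false} {true}  ga≡gb =
      ⊥-elim (s≢opposite[s] (g false) (trans ga≡gb (g-not false)))

    signLine-sign : ∀ {ε p q} ((l , l≡) : SignLine (g false) ε p) → p ≢ q →
                    ε p q ≡ g (offLine l (just q))
    signLine-sign {ε} {p} {q} (l , l≡) p≢q with on l q in lq
    ... | true  = proj₂ (proj₂ (l≡ q) lq)
    ... | false = trans (≢⇒≡opposite ε≢s) (sym (g-not false))
      where
      ε≢s : ε p q ≢ g false
      ε≢s ε≡s with () ← trans (sym (proj₁ (l≡ q) (≢-sym p≢q , ε≡s))) lq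

    signLines⇒existsUniqueOriented : ∀ ε → IsMultFactor 𝓕 ε → (∀ p → SignLine (g false) ε p) →
      ExistsUniqueOriented 𝓕 (λ α → ∀ p q → p ≢ q → ε p q ≡ g (α p (just q)))
    signLines⇒existsUniqueOriented ε ε-antisym line =
      α , ((α-linear , α-self , α-oriented) , α-sign) , α-unique
      where
      α : Fin 7 → VF 𝓕 → Bool
      α p = offLine (proj₁ (line p))
      α-linear : ∀ p → IsLinear 𝓕 (α p)
      α-linear p = offLine-isLinear (proj₁ (line p))
      α-self : ∀ p → α p (just p) ≡ true
      α-self p = cong not (signLine-avoids {ε = ε} (line p))
      α-sign : ∀ p q → p ≢ q → ε p q ≡ g (α p (just q))
      α-sign p q = signLine-sign {ε = ε} (line p)
      α-oriented : ∀ p q → p ≢ q → (α p (just q) xor α q (just p)) ≡ true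
      α-oriented p q p≢q = trans (cong (α p (just q) xor_) αqp≡not) (xor-not (α p (just q)))
        where
        open ≡-Reasoning
        αqp≡not : α q (just p) ≡ not (α p (just q))
        αqp≡not = g-injective (begin
          g (α q (just p))            ≡⟨ sym (α-sign q p (≢-sym p≢q)) ⟩
          ε q p                       ≡⟨ ε-antisym p q p≢q ⟩
          opposite (ε p q)            ≡⟨ cong opposite (α-sign p q p≢q) ⟩
          opposite (g (α p (just q))) ≡⟨ sym (g-not _) ⟩
          g (not (α p (just q)))      ∎)
      α-unique : ∀ β → IsOrientedMap 𝓕 β → (∀ p q → p ≢ q → ε p q ≡ g (β p (just q))) →
                 ∀ p x → β p x ≡ α p x
      α-unique β (β-linear , β-self , _) β-sign p nothing = proj₁ (β-linear p)
      α-unique β (β-linear , β-self , _) β-sign p (just q) with p ≟ q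
      ... | yes refl = trans (β-self p) (sym (α-self p))
      ... | no p≢q  = g-injective (trans (sym (β-sign p q p≢q)) (α-sign p q p≢q))

signPow-not : ∀ (𝓕 : FanoPlane) b → signPow 𝓕 (not b) ≡ opposite (signPow 𝓕 b)
signPow-not 𝓕 true  = refl
signPow-not 𝓕 false = refl

-- Both cases of the proposition only use that the future (resp. past) of every
-- point is a line.
proposition4p3 : ∀ {c ℓ} (𝓕 : FanoPlane) (𝔽 : Field c ℓ) → CharNot2 𝔽 →
    (ε : Fin 7 → Fin 7 → Sign) → IsMultFactor 𝓕 ε →
    Alg.IsCompositionAlgebra 𝓕 𝔽 ε →
      (Alg.In𝕆⁺₁ 𝓕 𝔽 ε → ExistsUniqueOriented 𝓕 (λ α →
          ∀ p q → p ≢ q → ε p q ≡ signPow 𝓕 (α p (just q))))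
      × (Alg.In𝕆⁻₁ 𝓕 𝔽 ε → ExistsUniqueOriented 𝓕 (λ α →
          ∀ p q → p ≢ q → ε p q ≡ opposite (signPow 𝓕 (α p (just q)))))
proposition4p3 𝓕 𝔽 _ ε ε-antisym _ =
    (λ (_ , future) → signLines⇒existsUniqueOriented 𝓕 (signPow 𝓕) (signPow-not 𝓕) ε ε-antisym future)
  , (λ (_ , past) → signLines⇒existsUniqueOriented 𝓕 (opposite ∘ signPow 𝓕)
                      (cong opposite ∘ signPow-not 𝓕) ε ε-antisym past)
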